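{- Let $\mathbf{a}$ be a weak $m$-part composition of $n\ge1$ and let $t=(k,l)$ with $0\le k\le n$ and $1\le l\le m$. Suppose $(k,l)$ is dominated by $\mathbf{a}^{j}$ for all $j$. Then each of the sets $B_0,\ldots,B_{n-1}$ is strongly complete with respect to $t$.
   Context: $\mathbf{a}=(a_0,\ldots,a_{m-1})$ is a tuple of nonnegative integers summing to $n$; indices read mod $m$. Let $f_{\mathbf{a}}(y)=a_r(y-r)+\sum_{j=0}^{r-1}a_j$ for $y\in[r,r+1]$, $0\le r<m$. A lattice point $(x,y)$ with $0\le y\le m$ is dominated by $\mathbf{a}$ if $x\ge f_{\mathbf{a}}(y)$. Cyclic shifts: $\mathbf{a}^{j}=(a_{ -j},\ldots,a_{ -j+m-1})$. For a lattice point $p=(x,y)$ with $0\le x<n$, $1\le y\le m$ and integer $r\ge0$, $S^{r}(p)=(x+a_{ -1}+\cdots+a_{ -r}\bmod n,\ y+r\bmod m)$ with residues in $\{0,\ldots,n-1\}$ and $\{1,\ldots,m\}$. For $0\le i<n$ let $y_i$ be the least integer with $i<f_{\mathbf{a}}(y_i)$, $p_i=(i,y_i)$, $s_i=m+1-y_i$, $b_i^r=S^{s_i+r}(p_i)$ for $0\le r<m$, and $B_i=\{b_i^0,\ldots,b_i^{m-1}\}$. $B_i$ is strongly complete with respect to $t=(k,l)$ if the $x$-coordinate of $b_i^{l-1}$ is strictly less than $k$. -}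

module Defs where

open import Data.Nat using (ℕ; zero; suc; _+_; _∸_; _≤_; _<_; _<?_; NonZero; _%_)
open import Data.Fin using (Fin; toℕ; fromℕ<)
open import Data.Integer using (ℤ; +_; -_; _-_)
open import Data.Integer.DivMod using (_%ℕ_; n%ℕd<d)
open import Data.Product using (_×_; _,_; proj₁)
open import Relation.Nullary using (yes; no)
open import Relation.Binary.PropositionalEquality using (_≡_)

sumTo : ℕ → (ℕ → ℕ) → ℕ
sumTo zero    g = 0
sumTo (suc y) g = sumTo y g + g y

Point : Set
Point = ℕ × ℕ

-- a weak m-part composition is a : Fin m → ℕ (entries a_0..a_{m-1});
-- at z : ℤ gives a_z with the index read mod m.
at : (m : ℕ) .{{_ : NonZero m}} → (Fin m → ℕ) → ℤ → ℕ
at m a z = a (fromℕ< (n%ℕd<d z m))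

IsComposition : (m : ℕ) .{{_ : NonZero m}} → (Fin m → ℕ) → ℕ → Set
IsComposition m a n = sumTo m (λ j → at m a (+ j)) ≡ n

-- f_a at an integer y equals the prefix sum a_0 + ... + a_{y-1}
-- (the piecewise-linear f_a agrees with this at integer points)
f : (m : ℕ) .{{_ : NonZero m}} → (Fin m → ℕ) → ℕ → ℕ
f m a y = sumTo y (λ j → at m a (+ j))

Dominated : (m : ℕ) .{{_ : NonZero m}} → (Fin m → ℕ) → Point → Set
Dominated m a (x , y) = y ≤ m × f m a y ≤ x

shift : (m : ℕ) .{{_ : NonZero m}} → (Fin m → ℕ) → ℤ → (Fin m → ℕ)
shift m a j r = at m a (+ toℕ r - j)

-- S^r(x,y) = (x + a_{-1} + ... + a_{-r} mod n, y + r mod m)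
-- residues in {0..n-1} and {1..m} respectively (y ≥ 1 assumed)
S : (m n : ℕ) .{{_ : NonZero m}} .{{_ : NonZero n}} → (Fin m → ℕ) → ℕ → Point → Point
S m n a r (x , y) =
  ((x + sumTo r (λ q → at m a (- (+ suc q)))) % n , suc ((y + r ∸ 1) % m))

-- least y in [start, start + fuel] with i < f_a(y) (start + fuel if none)
searchY : (m : ℕ) .{{_ : NonZero m}} → (Fin m → ℕ) → ℕ → ℕ → ℕ → ℕ
searchY m a i start zero = start
searchY m a i start (suc fuel) with i <? f m a start
... | yes _ = start
... | no  _ = searchY m a i (suc start) fuel

yIdx : (m : ℕ) .{{_ : NonZero m}} → (Fin m → ℕ) → ℕ → ℕ
yIdx m a i = searchY m a i 0 m

pIdx : (m : ℕ) .{{_ : NonZero m}} → (Fin m → ℕ) → ℕ → Point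
pIdx m a i = (i , yIdx m a i)

sIdx : (m : ℕ) .{{_ : NonZero m}} → (Fin m → ℕ) → ℕ → ℕ
sIdx m a i = suc m ∸ yIdx m a i

b : (m n : ℕ) .{{_ : NonZero m}} .{{_ : NonZero n}} → (Fin m → ℕ) → ℕ → ℕ → Point
b m n a i r = S m n a (sIdx m a i + r) (pIdx m a i)

B : (m n : ℕ) .{{_ : NonZero m}} .{{_ : NonZero n}} → (Fin m → ℕ) → ℕ → Fin m → Point
B m n a i r = b m n a i (toℕ r)

StronglyComplete : (m n : ℕ) .{{_ : NonZero m}} .{{_ : NonZero n}} → (Fin m → ℕ) → ℕ → Point → Set
StronglyComplete m n a i (k , l) = proj₁ (b m n a i (l ∸ 1)) < k

module Submission where

-- Fix i < n and write y = y_i = y' + 1, so that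
-- F(y') ≤ i < F(y) where F = f_a is the prefix-sum function, and let
-- D = m - y and L = l.  The x-coordinate of b_i^{l-1} is (i + X) mod n,
-- where X = a_{-1} + ... + a_{-(D+L)}.  Reading the indices mod m, X splits
-- as T + W with T = a_y + ... + a_{m-1} = n - F(y) and
-- W = a_{y-L} + ... + a_{y-1}.  The window W is exactly the prefix sum of
-- length L of the shift a^{L-y}, so domination gives W ≤ k; also
-- a_{y-1} ≤ W.  Hence i + X = n + (i - F(y) + W) with
-- 0 ≤ i - F(y) + W < W ≤ k ≤ n, and the residue is below k.

open import Defs
open import Data.Nat as ℕ using (ℕ; zero; suc; _≤_; _<_; NonZero; _+_; _∸_; _*_; z≤n; _%_; _<?_)
open import Data.Nat.Properties
open import Data.Nat.DivMod using ([m+n]%n≡m%n; m<n⇒m%n≡m)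
open import Data.Fin using (Fin; toℕ; fromℕ<)
open import Data.Fin.Properties using (toℕ-injective; toℕ-fromℕ<)
open import Data.Integer as ℤ using (ℤ; +_; -[1+_])
open import Data.Integer.DivMod using (_%ℕ_; _/ℕ_; n%ℕd<d; a≡a%ℕn+[a/ℕn]*n)
open import Data.Empty using (⊥-elim)
import Data.Integer.Properties as ℤP
open import Data.Integer.Tactic.RingSolver using (solve-∀)
open import Data.Product using (Σ; _×_; _,_; proj₁)
open import Relation.Binary.PropositionalEquality
open import Relation.Nullary using (yes; no)
open import Data.Sum using (inj₁; inj₂)

sumTo-cong : ∀ r {g h : ℕ → ℕ} → (∀ q → q < r → g q ≡ h q) → sumTo r g ≡ sumTo r h
sumTo-cong zero    e = refl
sumTo-cong (suc r) e = cong₂ _+_ (sumTo-cong r (λ q q<r → e q (m<n⇒m<1+n q<r))) (e r ≤-refl)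

sumTo-split : ∀ A B g → sumTo (A + B) g ≡ sumTo A g + sumTo B (λ q → g (A + q))
sumTo-split A zero g rewrite +-identityʳ A = sym (+-identityʳ (sumTo A g))
sumTo-split A (suc B) g rewrite +-suc A B | sumTo-split A B g = +-assoc (sumTo A g) _ _

sumTo-reverse : ∀ r g → sumTo r g ≡ sumTo r (λ q → g (r ∸ suc q))
sumTo-reverse zero    g = refl
sumTo-reverse (suc r) g = begin
  sumTo r g + g r                                  ≡⟨ +-comm (sumTo r g) (g r) ⟩
  g r + sumTo r g                                  ≡⟨ cong (_+_ (g r)) (sumTo-reverse r g) ⟩
  g r + sumTo r (λ q → g (r ∸ suc q))              ≡⟨ sym (sumTo-split 1 r (λ q → g (suc r ∸ suc q))) ⟩
  sumTo (suc r) (λ q → g (suc r ∸ suc q))          ∎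
  where open ≡-Reasoning

term≤sumTo : ∀ {q r} g → q < r → g q ≤ sumTo r g
term≤sumTo {q} {suc r} g q<1+r with m≤n⇒m<n∨m≡n q<1+r
... | inj₁ (ℕ.s≤s q<r) = ≤-trans (term≤sumTo g q<r) (m≤m+n (sumTo r g) (g r))
... | inj₂ refl        = m≤n+m (g r) (sumTo r g)

residue-unique : ∀ {M r₁ r₂} (d : ℤ) → r₁ < M → r₂ < M →
                 + r₁ ≡ + r₂ ℤ.+ d ℤ.* + M → r₁ ≡ r₂
residue-unique {M} {r₁} {r₂} (+ zero) _ _ e = ℤP.+-injective (begin
  + r₁                  ≡⟨ e ⟩
  + r₂ ℤ.+ + 0 ℤ.* + M  ≡⟨ cong (ℤ._+_ (+ r₂)) (ℤP.*-zeroˡ (+ M)) ⟩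
  + r₂ ℤ.+ + 0          ≡⟨ ℤP.+-identityʳ (+ r₂) ⟩
  + r₂                  ∎)
  where open ≡-Reasoning
residue-unique {M} {r₁} {r₂} (+ suc d) r₁<M _ e =
  ⊥-elim (<⇒≱ r₁<M (subst (M ≤_) (sym r₁≡) (≤-trans (m≤m+n M (d * M)) (m≤n+m _ r₂))))
  where
  r₁≡ : r₁ ≡ r₂ + suc d * M
  r₁≡ = ℤP.+-injective (trans e (cong (ℤ._+_ (+ r₂)) (sym (ℤP.pos-* (suc d) M))))
residue-unique {M} {r₁} {r₂} -[1+ d ] r₁<M r₂<M e =
  sym (residue-unique (+ suc d) r₂<M r₁<M (begin
    + r₂                                                ≡⟨ move (+ r₂) -[1+ d ] (+ M) ⟩
    (+ r₂ ℤ.+ -[1+ d ] ℤ.* + M) ℤ.+ + suc d ℤ.* + M      ≡⟨ cong (ℤ._+ + suc d ℤ.* + M) (sym e) ⟩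
    + r₁ ℤ.+ + suc d ℤ.* + M                             ∎))
  where
  open ≡-Reasoning
  move : ∀ (x c N : ℤ) → x ≡ (x ℤ.+ c ℤ.* N) ℤ.+ (ℤ.- c) ℤ.* N
  move = solve-∀

%ℕ-periodic : ∀ M .{{_ : NonZero M}} z c → (z ℤ.+ c ℤ.* + M) %ℕ M ≡ z %ℕ M
%ℕ-periodic M z c = residue-unique (q₁ ℤ.+ c ℤ.- q₂) (n%ℕd<d z' M) (n%ℕd<d z M) (begin
  + r₂                                      ≡⟨ cancel (+ r₂) q₂ (+ M) ⟩
  (+ r₂ ℤ.+ q₂ ℤ.* + M) ℤ.- q₂ ℤ.* + M       ≡⟨ cong (ℤ._- q₂ ℤ.* + M) (sym (a≡a%ℕn+[a/ℕn]*n z' M)) ⟩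
  z' ℤ.- q₂ ℤ.* + M                         ≡⟨ cong (λ w → w ℤ.+ c ℤ.* + M ℤ.- q₂ ℤ.* + M) (a≡a%ℕn+[a/ℕn]*n z M) ⟩
  (+ r₁ ℤ.+ q₁ ℤ.* + M) ℤ.+ c ℤ.* + M ℤ.- q₂ ℤ.* + M ≡⟨ regroup (+ r₁) q₁ c q₂ (+ M) ⟩
  + r₁ ℤ.+ (q₁ ℤ.+ c ℤ.- q₂) ℤ.* + M         ∎)
  where
  open ≡-Reasoning
  z' = z ℤ.+ c ℤ.* + M
  r₁ = z %ℕ M
  r₂ = z' %ℕ M
  q₁ = z /ℕ M
  q₂ = z' /ℕ M
  cancel : ∀ (x q N : ℤ) → x ≡ (x ℤ.+ q ℤ.* N) ℤ.- q ℤ.* N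
  cancel = solve-∀
  regroup : ∀ (x q c p N : ℤ) → (x ℤ.+ q ℤ.* N) ℤ.+ c ℤ.* N ℤ.- p ℤ.* N ≡ x ℤ.+ (q ℤ.+ c ℤ.- p) ℤ.* N
  regroup = solve-∀

window : (ℤ → ℕ) → ℤ → ℕ → ℕ
window g z r = sumTo r (λ q → g (z ℤ.+ + q))

backward : (ℤ → ℕ) → ℤ → ℕ → ℕ
backward g z r = sumTo r (λ q → g (z ℤ.- + suc q))

window-split : ∀ g z A B → window g z (A + B) ≡ window g z A + window g (z ℤ.+ + A) B
window-split g z A B = trans (sumTo-split A B _)
  (cong (_+_ (window g z A)) (sumTo-cong B (λ q _ → cong g (sym (ℤP.+-assoc z (+ A) (+ q))))))

backward-split : ∀ g z D L → backward g z (D + L) ≡ backward g z D + backward g (z ℤ.- + D) L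
backward-split g z D L = trans (sumTo-split D L _)
  (cong (_+_ (backward g z D)) (sumTo-cong L (λ q _ → cong g (regroup z (+ D) (+ q)))))
  where
  regroup : ∀ (x d q : ℤ) → x ℤ.- (+ 1 ℤ.+ (d ℤ.+ q)) ≡ (x ℤ.- d) ℤ.- (+ 1 ℤ.+ q)
  regroup = solve-∀

backward≡window : ∀ g c r → backward g (c ℤ.+ + r) r ≡ window g c r
backward≡window g c r = sym (trans (sumTo-reverse r _) (sumTo-cong r same-index))
  where
  same-index : ∀ q → q < r → g (c ℤ.+ + (r ∸ suc q)) ≡ g (c ℤ.+ + r ℤ.- + suc q)
  same-index q q<r = cong g (begin
    c ℤ.+ + (r ∸ suc q)          ≡⟨ cong (ℤ._+_ c) (sym (trans (ℤP.m-n≡m⊖n r (suc q)) (ℤP.⊖-≥ q<r))) ⟩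
    c ℤ.+ (+ r ℤ.- + suc q)      ≡⟨ sym (ℤP.+-assoc c (+ r) (ℤ.- + suc q)) ⟩
    c ℤ.+ + r ℤ.- + suc q        ∎)
    where open ≡-Reasoning

-- The wrap-around estimate: if i lies in the block [F, F + a) of a
-- decomposition F + a + T = n, and a ≤ W ≤ k ≤ n, then the residue of
-- i + T + W modulo n is i - (F + a) + W, which is below W, hence below k.
wrapped-residue< : ∀ n .{{_ : NonZero n}} {F a T i W k} →
                   F + a + T ≡ n → F ≤ i → i < F + a → a ≤ W → W ≤ k → k ≤ n →
                   (i + (T + W)) % n < k
wrapped-residue< n {F} {a} {T} {i} {W} {k} total F≤i i<F+a a≤W W≤k k≤n =
  subst (_< k) (sym residue) v<k
  where
  open ≡-Reasoning
  F+a≤i+W : F + a ≤ i + W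
  F+a≤i+W = +-mono-≤ F≤i a≤W
  v = i + W ∸ (F + a)
  v<k : v < k
  v<k = <-≤-trans (subst (v <_) (m+n∸m≡n (F + a) W) (∸-monoˡ-< (+-monoˡ-< W i<F+a) F+a≤i+W)) W≤k
  residue : (i + (T + W)) % n ≡ v
  residue = begin
    (i + (T + W)) % n      ≡⟨ cong (_% n) (begin
        i + (T + W)          ≡⟨ cong (_+_ i) (+-comm T W) ⟩
        i + (W + T)          ≡⟨ sym (+-assoc i W T) ⟩
        i + W + T            ≡⟨ cong (_+ T) (sym (m∸n+n≡m F+a≤i+W)) ⟩
        v + (F + a) + T      ≡⟨ +-assoc v (F + a) T ⟩
        v + (F + a + T)      ≡⟨ cong (_+_ v) total ⟩
        v + n                ∎) ⟩
    (v + n) % n            ≡⟨ [m+n]%n≡m%n v n ⟩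
    v % n                  ≡⟨ m<n⇒m%n≡m (<-≤-trans v<k k≤n) ⟩
    v                      ∎

module _ (m : ℕ) .{{_ : NonZero m}} (a : Fin m → ℕ) where

  at-residue : ∀ {z z'} → z %ℕ m ≡ z' %ℕ m → at m a z ≡ at m a z'
  at-residue e = cong a (toℕ-injective (trans (toℕ-fromℕ< _) (trans e (sym (toℕ-fromℕ< _)))))

  at-periodic : ∀ z c → at m a (z ℤ.+ c ℤ.* + m) ≡ at m a z
  at-periodic z c = at-residue {z ℤ.+ c ℤ.* + m} {z} (%ℕ-periodic m z c)

  at-shift : ∀ j z → at m (shift m a j) z ≡ at m a (z ℤ.- j)
  at-shift j z = begin
    at m a (+ toℕ (fromℕ< _) ℤ.- j)                 ≡⟨ cong (λ x → at m a (+ x ℤ.- j)) (toℕ-fromℕ< _) ⟩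
    at m a (+ r ℤ.- j)                              ≡⟨ sym (at-periodic (+ r ℤ.- j) q) ⟩
    at m a ((+ r ℤ.- j) ℤ.+ q ℤ.* + m)              ≡⟨ cong (at m a) (regroup (+ r) q j (+ m)) ⟩
    at m a ((+ r ℤ.+ q ℤ.* + m) ℤ.- j)              ≡⟨ cong (λ w → at m a (w ℤ.- j)) (sym (a≡a%ℕn+[a/ℕn]*n z m)) ⟩
    at m a (z ℤ.- j)                                ∎
    where
    open ≡-Reasoning
    r = z %ℕ m
    q = z /ℕ m
    regroup : ∀ (x q j N : ℤ) → (x ℤ.- j) ℤ.+ q ℤ.* N ≡ (x ℤ.+ q ℤ.* N) ℤ.- j
    regroup = solve-∀

  backward-periodic : ∀ z r → backward (at m a) (z ℤ.+ + m) r ≡ backward (at m a) z r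
  backward-periodic z r = sumTo-cong r (λ q _ →
    trans (cong (at m a) (regroup z (+ m) (+ suc q))) (at-periodic (z ℤ.- + suc q) (+ 1)))
    where
    regroup : ∀ (z N s : ℤ) → z ℤ.+ N ℤ.- s ≡ (z ℤ.- s) ℤ.+ + 1 ℤ.* N
    regroup = solve-∀

  shifted-prefix : ∀ Y L → f m (shift m a (+ L ℤ.- + Y)) L ≡ backward (at m a) (+ Y) L
  shifted-prefix Y L = begin
    f m (shift m a (+ L ℤ.- + Y)) L                  ≡⟨ sumTo-cong L (λ q _ →
                                                         trans (at-shift (+ L ℤ.- + Y) (+ q))
                                                               (cong (at m a) (reindex (+ q) (+ L) (+ Y)))) ⟩
    window (at m a) (+ Y ℤ.- + L) L                  ≡⟨ sym (backward≡window (at m a) (+ Y ℤ.- + L) L) ⟩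
    backward (at m a) ((+ Y ℤ.- + L) ℤ.+ + L) L      ≡⟨ cong (λ z → backward (at m a) z L) (cancel (+ Y) (+ L)) ⟩
    backward (at m a) (+ Y) L                        ∎
    where
    open ≡-Reasoning
    reindex : ∀ (q L Y : ℤ) → q ℤ.- (L ℤ.- Y) ≡ (Y ℤ.- L) ℤ.+ q
    reindex = solve-∀
    cancel : ∀ (Y L : ℤ) → (Y ℤ.- L) ℤ.+ L ≡ Y
    cancel = solve-∀

  tail-sum : ∀ {n Y D} → IsComposition m a n → m ≡ Y + D →
             f m a Y + window (at m a) (+ Y) D ≡ n
  tail-sum {n} {Y} {D} comp m≡Y+D = begin
    f m a Y + window (at m a) (+ Y) D   ≡⟨ sym (window-split (at m a) (+ 0) Y D) ⟩
    f m a (Y + D)                       ≡⟨ cong (f m a) (sym m≡Y+D) ⟩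
    f m a m                             ≡⟨ comp ⟩
    n                                   ∎
    where open ≡-Reasoning

  backward-from-zero : ∀ {Y D} L → m ≡ Y + D →
    sumTo (D + L) (λ q → at m a (ℤ.- (+ suc q)))
      ≡ window (at m a) (+ Y) D + backward (at m a) (+ Y) L
  backward-from-zero {Y} {D} L m≡Y+D = begin
    backward (at m a) (+ 0) (D + L)                             ≡⟨ sym (backward-periodic (+ 0) (D + L)) ⟩
    backward (at m a) (+ m) (D + L)                             ≡⟨ backward-split (at m a) (+ m) D L ⟩
    backward (at m a) (+ m) D + backward (at m a) (+ m ℤ.- + D) L ≡⟨ cong₂ (λ u v → backward (at m a) u D + backward (at m a) v L)
                                                                      (cong +_ m≡Y+D) (trans (cong (λ x → + x ℤ.- + D) m≡Y+D) (cancel (+ Y) (+ D))) ⟩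
    backward (at m a) (+ Y ℤ.+ + D) D + backward (at m a) (+ Y) L ≡⟨ cong (_+ backward (at m a) (+ Y) L) (backward≡window (at m a) (+ Y) D) ⟩
    window (at m a) (+ Y) D + backward (at m a) (+ Y) L         ∎
    where
    open ≡-Reasoning
    cancel : ∀ (Y D : ℤ) → (Y ℤ.+ D) ℤ.- D ≡ Y
    cancel = solve-∀

  PredBelow : ℕ → ℕ → Set
  PredBelow i y = ∀ {y'} → y ≡ suc y' → f m a y' ≤ i

  searchY-spec : ∀ i start fuel → PredBelow i start → i < f m a (start + fuel) →
                 let y = searchY m a i start fuel in
                 PredBelow i y × y ≤ start + fuel × i < f m a y
  searchY-spec i start zero below i<F =
    below , m≤m+n start 0 , subst (λ y → i < f m a y) (+-identityʳ start) i<F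
  searchY-spec i start (suc fuel) below i<F with i <? f m a start
  ... | yes i<F-here = below , m≤m+n start (suc fuel) , i<F-here
  ... | no  i≮F-here with searchY-spec i (suc start) fuel (λ { refl → ≮⇒≥ i≮F-here })
                            (subst (λ y → i < f m a y) (+-suc start fuel) i<F)
  ...   | below′ , y≤ , i<F′ = below′ , ≤-trans y≤ (≤-reflexive (sym (+-suc start fuel))) , i<F′

  yIdx-bracket : ∀ {n i} → IsComposition m a n → i < n →
                 Σ ℕ λ y' → yIdx m a i ≡ suc y' × y' < m × f m a y' ≤ i × i < f m a (suc y')
  yIdx-bracket {n} {i} comp i<n =
    bracket (searchY-spec i 0 m (λ ()) (subst (i <_) (sym comp) i<n))
    where
    bracket : ∀ {y} → PredBelow i y × y ≤ m × i < f m a y →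
              Σ ℕ λ y' → y ≡ suc y' × y' < m × f m a y' ≤ i × i < f m a (suc y')
    bracket {zero}   (_ , _ , ())
    bracket {suc y'} (below , y≤m , i<F) = y' , refl , y≤m , below refl , i<F

  x-coordinate< : ∀ n .{{_ : NonZero n}} → IsComposition m a n →
                  ∀ {k l' i y'} → k ≤ n → y' < m →
                  Dominated m (shift m a (+ suc l' ℤ.- + suc y')) (k , suc l') →
                  f m a y' ≤ i → i < f m a (suc y') →
                  proj₁ (S m n a (m ∸ y' + l') (i , suc y')) < k
  x-coordinate< n comp {k} {l'} {i} {y'} k≤n y'<m (_ , dominated) F≤i i<F =
    subst (λ X → (i + X) % n < k) (sym offset)
      (wrapped-residue< n (tail-sum {n} {Y} {D} comp m≡Y+D) F≤i i<F last≤W W≤k k≤n)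
    where
    open ≡-Reasoning
    Y = suc y'
    L = suc l'
    D = m ∸ Y
    m≡Y+D : m ≡ Y + D
    m≡Y+D = sym (m+[n∸m]≡n y'<m)
    W = backward (at m a) (+ Y) L
    W≤k : W ≤ k
    W≤k = subst (_≤ k) (shifted-prefix Y L) dominated
    last≤W : at m a (+ y') ≤ W
    last≤W = term≤sumTo {0} {L} (λ q → at m a (+ Y ℤ.- + suc q)) (ℕ.s≤s z≤n)
    offset : sumTo (m ∸ y' + l') (λ q → at m a (ℤ.- (+ suc q))) ≡ window (at m a) (+ Y) D + W
    offset = begin
      sumTo (m ∸ y' + l') (λ q → at m a (ℤ.- (+ suc q)))  ≡⟨ cong (λ R → sumTo (R + l') (λ q → at m a (ℤ.- (+ suc q)))) (+-∸-assoc 1 y'<m) ⟩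
      sumTo (suc D + l') (λ q → at m a (ℤ.- (+ suc q)))   ≡⟨ cong (λ R → sumTo R (λ q → at m a (ℤ.- (+ suc q)))) (sym (+-suc D l')) ⟩
      sumTo (D + L) (λ q → at m a (ℤ.- (+ suc q)))        ≡⟨ backward-from-zero {Y} {D} L m≡Y+D ⟩
      window (at m a) (+ Y) D + W                         ∎

-- With y_i = y' + 1 we have s_i + (l - 1) = (m - y') + l', so b_i^{l-1} is the
-- point estimated in 'x-coordinate<', for the shift j = l - y_i.
lemma4 : (m n : ℕ) .{{_ : NonZero m}} .{{_ : NonZero n}} (a : Fin m → ℕ) →
         IsComposition m a n →
         (k l : ℕ) → k ≤ n → 1 ≤ l → l ≤ m →
         ((j : ℤ) → Dominated m (shift m a j) (k , l)) →
         (i : ℕ) → i < n → StronglyComplete m n a i (k , l)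
lemma4 m n a comp k zero    k≤n () _ dom i i<n
lemma4 m n a comp k (suc l') k≤n _ _ dom i i<n
  with yIdx m a i | yIdx-bracket m a comp i<n
... | _ | y' , refl , y'<m , F≤i , i<F =
  x-coordinate< m a n comp k≤n y'<m (dom (+ suc l' ℤ.- + suc y')) F≤i i<F
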